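{- For $n\ge 0$ let $$\begin{aligned} F_{n;1}^{(I)}(x) &= \sum_{k=0}^{n} \binom{n}{k}^2 \binom{n+k}{k} \left( -3H_k + 2 H_{n-k} \right) \frac{x^k}{k!} - \sum_{k=0}^{n} \binom{n}{k}^2 \frac{x^k}{k!} \sum_{l=1}^{n} \binom{n+k}{n-l} \frac{(-1)^l}{l}, \\ F_{n;2}^{(I)}(x) &= \sum_{k=0}^{n} \binom{n}{k}^2 \binom{n+k}{k} \frac{x^k}{k!}, \end{aligned}$$ where $H_l=\sum_{j=1}^l 1/j$. Then $n!\, \mathrm{lcm}(1,\dots,n)\, F_{n;1}^{(I)}(x)\in\mathbb{Z}[x]$ and $n!\, F_{n;2}^{(I)}(x) \in\mathbb{Z}[x]$.
   Context: $\mathrm{lcm}(1,\dots,n)$ is the least common multiple of $1,\dots,n$ (equal to $1$ for $n=0$); $\binom{a}{b}=0$ when $b<0$. -}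

module Defs where

open import Data.Nat using (ℕ; zero; suc; _!; _∸_) renaming (_+_ to _+ℕ_; _*_ to _*ℕ_)
open import Data.Nat.Properties using (_!≢0)
open import Data.Nat.LCM using (lcm)
open import Data.Nat.Combinatorics using (_C_)
open import Data.Integer using (ℤ; +_; -[1+_])
open import Data.Rational using (ℚ; _/_; _+_; _*_; _-_; 0ℚ; -_)
open import Data.List using (List; map; foldr; upTo)
open import Data.List.Relation.Unary.All using (All)
open import Data.Product using (∃)
open import Relation.Binary.PropositionalEquality using (_≡_)

lcmUpTo : ℕ → ℕ
lcmUpTo zero    = 1
lcmUpTo (suc n) = lcm (suc n) (lcmUpTo n)

ℕtoℚ : ℕ → ℚ
ℕtoℚ m = (+ m) / 1

invFact : ℕ → ℚ
invFact k = (+ 1 / (k !)) {{k !≢0}}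

invSuc : ℕ → ℚ
invSuc m = + 1 / suc m

sumℚ : List ℚ → ℚ
sumℚ = foldr _+_ 0ℚ

H : ℕ → ℚ
H l = sumℚ (map invSuc (upTo l))

sgn : ℕ → ℚ
sgn zero    = + 1 / 1
sgn (suc l) = - sgn l

-- inner sum Σ_{l=1}^{n} binom(n+k, n-l) (-1)^l / l   (here l = suc m, m < n)
innerSum : ℕ → ℕ → ℚ
innerSum n k = sumℚ (map (λ m → ℕtoℚ ((n +ℕ k) C (n ∸ suc m)) * sgn (suc m) * invSuc m) (upTo n))

coeff1 : ℕ → ℕ → ℚ
coeff1 n k =
  ℕtoℚ ((n C k) *ℕ (n C k) *ℕ ((n +ℕ k) C k))
    * (- (ℕtoℚ 3 * H k) + ℕtoℚ 2 * H (n ∸ k)) * invFact k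
  - ℕtoℚ ((n C k) *ℕ (n C k)) * invFact k * innerSum n k

coeff2 : ℕ → ℕ → ℚ
coeff2 n k = ℕtoℚ ((n C k) *ℕ (n C k) *ℕ ((n +ℕ k) C k)) * invFact k

-- a polynomial in ℚ[x] as its coefficient list [c_0, c_1, …, c_n]
F1 : ℕ → List ℚ
F1 n = map (coeff1 n) (upTo (suc n))

F2 : ℕ → List ℚ
F2 n = map (coeff2 n) (upTo (suc n))

scale : ℚ → List ℚ → List ℚ
scale c = map (c *_)

IsIntegral : ℚ → Set
IsIntegral q = ∃ λ (z : ℤ) → q ≡ z / 1

InZx : List ℚ → Set
InZx p = All IsIntegral p

-- Each coefficient of x^k is 1/k! times an expression that is integral except for reciprocals
-- 1/j with 1 ≤ j ≤ n, which occur only linearly (in H_k, H_(n-k) and the inner sum).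
-- Since k ≤ n, n!/k! is an integer, and so is lcm(1,…,n)/j for each such j.
module Submission where

open import Defs
open import Data.Nat as ℕ using (ℕ; zero; suc; _!; _*_; _≤_; _<_; s≤s; NonZero)
open import Data.Nat.Properties using (_!≢0; m≤n⇒m<n∨m≡n; <-≤-trans; m∸n≤m; ≤-pred)
open import Data.Nat.Combinatorics using (_C_)
open import Data.Nat.Divisibility using (_∣_; divides; ∣-trans; m≤n⇒m!∣n!)
open import Data.Nat.LCM using (m∣lcm[m,n]; n∣lcm[m,n])
open import Data.Integer as ℤ using (+_)
import Data.Integer.Properties as ℤ
open import Data.Rational using (ℚ; _/_; 1ℚ; toℚᵘ)
  renaming (_+_ to _+ℚ_; _*_ to _*ℚ_; -_ to -ℚ_; _-_ to _-ℚ_)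
open import Data.Rational.Properties
  using (toℚᵘ-injective; toℚᵘ-fromℚᵘ; toℚᵘ-homo-+; toℚᵘ-homo-*; toℚᵘ-homo‿-;
         *-zeroʳ; *-distribˡ-+; *-assoc; *-identityʳ)
open import Data.Rational.Solver using (module +-*-Solver)
import Data.Rational.Unnormalised as ℚᵘ
import Data.Rational.Unnormalised.Properties as ℚᵘ
open import Data.List using ([]; _∷_; map; upTo)
open import Data.List.Relation.Unary.All using (All; []; _∷_)
open import Data.List.Relation.Unary.All.Properties using (map⁺; applyUpTo⁺₁)
open import Data.Product using (_×_; _,_)
open import Data.Sum using (inj₁; inj₂)
open import Function using (id)
open import Relation.Binary.PropositionalEquality

open +-*-Solver

toℚᵘ-/ : ∀ i d → toℚᵘ (i / suc d) ℚᵘ.≃ ℚᵘ.mkℚᵘ i d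
toℚᵘ-/ i d = toℚᵘ-fromℚᵘ (ℚᵘ.mkℚᵘ i d)

≃mkℚᵘ⇒≡/1 : ∀ {p} z → toℚᵘ p ℚᵘ.≃ ℚᵘ.mkℚᵘ z 0 → p ≡ z / 1
≃mkℚᵘ⇒≡/1 z p≃z = toℚᵘ-injective (ℚᵘ.≃-trans p≃z (ℚᵘ.≃-sym (toℚᵘ-/ z 0)))

/1-homo-+ : ∀ a b → (a / 1) +ℚ (b / 1) ≡ (a ℤ.+ b) / 1
/1-homo-+ a b = ≃mkℚᵘ⇒≡/1 (a ℤ.+ b) (ℚᵘ.≃-trans (toℚᵘ-homo-+ (a / 1) (b / 1))
  (ℚᵘ.≃-trans (ℚᵘ.+-cong (toℚᵘ-/ a 0) (toℚᵘ-/ b 0))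
    (ℚᵘ.≃-reflexive (cong (λ z → ℚᵘ.mkℚᵘ z 0)
      (cong₂ ℤ._+_ (ℤ.*-identityʳ a) (ℤ.*-identityʳ b))))))

/1-homo-* : ∀ a b → (a / 1) *ℚ (b / 1) ≡ (a ℤ.* b) / 1
/1-homo-* a b = ≃mkℚᵘ⇒≡/1 (a ℤ.* b) (ℚᵘ.≃-trans (toℚᵘ-homo-* (a / 1) (b / 1))
  (ℚᵘ.*-cong (toℚᵘ-/ a 0) (toℚᵘ-/ b 0)))

/1-homo‿- : ∀ a → -ℚ (a / 1) ≡ (ℤ.- a) / 1
/1-homo‿- a = ≃mkℚᵘ⇒≡/1 (ℤ.- a) (ℚᵘ.≃-trans (toℚᵘ-homo‿- (a / 1)) (ℚᵘ.-‿cong (toℚᵘ-/ a 0)))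

ℕtoℚ-* : ∀ a b → ℕtoℚ (a * b) ≡ ℕtoℚ a *ℚ ℕtoℚ b
ℕtoℚ-* a b = trans (cong (_/ 1) (ℤ.pos-* a b)) (sym (/1-homo-* (+ a) (+ b)))

ℕtoℚ-*-inverseʳ : ∀ d .{{_ : NonZero d}} → ℕtoℚ d *ℚ (+ 1 / d) ≡ 1ℚ
-- ℚᵘ.1/ (mkℚᵘ (+ suc d) 0) computes to mkℚᵘ (+ 1) d.
ℕtoℚ-*-inverseʳ (suc d) = toℚᵘ-injective (ℚᵘ.≃-trans (toℚᵘ-homo-* (ℕtoℚ (suc d)) (+ 1 / suc d))
  (ℚᵘ.≃-trans (ℚᵘ.*-cong (toℚᵘ-/ (+ suc d) 0) (toℚᵘ-/ (+ 1) d))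
    (ℚᵘ.*-inverseʳ (ℚᵘ.mkℚᵘ (+ suc d) 0))))

isIntegral-ℕtoℚ : ∀ m → IsIntegral (ℕtoℚ m)
isIntegral-ℕtoℚ m = + m , refl

isIntegral-+ : ∀ {x y} → IsIntegral x → IsIntegral y → IsIntegral (x +ℚ y)
isIntegral-+ (a , refl) (b , refl) = a ℤ.+ b , /1-homo-+ a b

isIntegral-* : ∀ {x y} → IsIntegral x → IsIntegral y → IsIntegral (x *ℚ y)
isIntegral-* (a , refl) (b , refl) = a ℤ.* b , /1-homo-* a b

isIntegral-neg : ∀ {x} → IsIntegral x → IsIntegral (-ℚ x)
isIntegral-neg (a , refl) = ℤ.- a , /1-homo‿- a

isIntegral-minus : ∀ {x y} → IsIntegral x → IsIntegral y → IsIntegral (x -ℚ y)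
isIntegral-minus x∈ℤ y∈ℤ = isIntegral-+ x∈ℤ (isIntegral-neg y∈ℤ)

isIntegral-sgn : ∀ l → IsIntegral (sgn l)
isIntegral-sgn zero    = + 1 , refl
isIntegral-sgn (suc l) = isIntegral-neg (isIntegral-sgn l)

isIntegral-*-sumℚ : ∀ c xs → All (λ x → IsIntegral (c *ℚ x)) xs → IsIntegral (c *ℚ sumℚ xs)
isIntegral-*-sumℚ c []       []           = subst IsIntegral (sym (*-zeroʳ c)) (isIntegral-ℕtoℚ 0)
isIntegral-*-sumℚ c (x ∷ xs) (cx ∷ cxs) =
  subst IsIntegral (sym (*-distribˡ-+ c x (sumℚ xs))) (isIntegral-+ cx (isIntegral-*-sumℚ c xs cxs))

∣⇒isIntegral[m*1/d] : ∀ {d m} .{{_ : NonZero d}} → d ∣ m → IsIntegral (ℕtoℚ m *ℚ (+ 1 / d))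
∣⇒isIntegral[m*1/d] {d} (divides q refl) = subst IsIntegral (sym q*d/d≡q) (isIntegral-ℕtoℚ q)
  where
  open ≡-Reasoning
  q*d/d≡q : ℕtoℚ (q * d) *ℚ (+ 1 / d) ≡ ℕtoℚ q
  q*d/d≡q = begin
    ℕtoℚ (q * d) *ℚ (+ 1 / d)         ≡⟨ cong (_*ℚ (+ 1 / d)) (ℕtoℚ-* q d) ⟩
    ℕtoℚ q *ℚ ℕtoℚ d *ℚ (+ 1 / d)     ≡⟨ *-assoc (ℕtoℚ q) (ℕtoℚ d) (+ 1 / d) ⟩
    ℕtoℚ q *ℚ (ℕtoℚ d *ℚ (+ 1 / d))   ≡⟨ cong (ℕtoℚ q *ℚ_) (ℕtoℚ-*-inverseʳ d) ⟩
    ℕtoℚ q *ℚ 1ℚ                      ≡⟨ *-identityʳ (ℕtoℚ q) ⟩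
    ℕtoℚ q                            ∎

map-upTo⁺ : ∀ {A : Set} {P : A → Set} (f : ℕ → A) n → (∀ {i} → i < n → P (f i)) → All P (map f (upTo n))
map-upTo⁺ f n Pf = map⁺ (applyUpTo⁺₁ id n Pf)

suc∣lcmUpTo : ∀ {m n} → suc m ≤ n → suc m ∣ lcmUpTo n
suc∣lcmUpTo {m} {suc n} (s≤s m≤n) with m≤n⇒m<n∨m≡n m≤n
... | inj₁ m<n  = ∣-trans (suc∣lcmUpTo m<n) (n∣lcm[m,n] (suc n) (lcmUpTo n))
... | inj₂ refl = m∣lcm[m,n] (suc m) (lcmUpTo m)

lcmUpTo*invSuc-isIntegral : ∀ {j n} → j < n → IsIntegral (ℕtoℚ (lcmUpTo n) *ℚ invSuc j)
lcmUpTo*invSuc-isIntegral j<n = ∣⇒isIntegral[m*1/d] (suc∣lcmUpTo j<n)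

lcmUpTo*H-isIntegral : ∀ {k n} → k ≤ n → IsIntegral (ℕtoℚ (lcmUpTo n) *ℚ H k)
lcmUpTo*H-isIntegral {k} {n} k≤n = isIntegral-*-sumℚ (ℕtoℚ (lcmUpTo n)) (map invSuc (upTo k))
  (map-upTo⁺ invSuc k (λ j<k → lcmUpTo*invSuc-isIntegral (<-≤-trans j<k k≤n)))

lcmUpTo*innerSum-isIntegral : ∀ n k → IsIntegral (ℕtoℚ (lcmUpTo n) *ℚ innerSum n k)
lcmUpTo*innerSum-isIntegral n k =
  isIntegral-*-sumℚ L (map term (upTo n)) (map-upTo⁺ term n L*term-isIntegral)
  where
  L : ℚ
  L = ℕtoℚ (lcmUpTo n)
  binom : ℕ → ℕ
  binom m = (n ℕ.+ k) C (n ℕ.∸ suc m)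
  term : ℕ → ℚ
  term m = ℕtoℚ (binom m) *ℚ sgn (suc m) *ℚ invSuc m
  move-L : ∀ L b s i → b *ℚ s *ℚ (L *ℚ i) ≡ L *ℚ (b *ℚ s *ℚ i)
  move-L = solve 4 (λ L b s i → b :* s :* (L :* i) := L :* (b :* s :* i)) refl
  L*term-isIntegral : ∀ {m} → m < n → IsIntegral (L *ℚ term m)
  L*term-isIntegral {m} m<n =
    subst IsIntegral (move-L L (ℕtoℚ (binom m)) (sgn (suc m)) (invSuc m))
      (isIntegral-* (isIntegral-* (isIntegral-ℕtoℚ (binom m)) (isIntegral-sgn (suc m)))
                    (lcmUpTo*invSuc-isIntegral m<n))

n!*invFact-isIntegral : ∀ {k n} → k ≤ n → IsIntegral (ℕtoℚ (n !) *ℚ invFact k)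
n!*invFact-isIntegral {k} k≤n = ∣⇒isIntegral[m*1/d] {{k !≢0}} (m≤n⇒m!∣n! k≤n)

coeff1-isIntegral : ∀ {n k} → k ≤ n → IsIntegral (ℕtoℚ ((n !) * lcmUpTo n) *ℚ coeff1 n k)
coeff1-isIntegral {n} {k} k≤n = subst IsIntegral (sym n!L*coeff1≡)
  (isIntegral-minus
    (isIntegral-* (isIntegral-* (isIntegral-ℕtoℚ A)
      (isIntegral-+ (isIntegral-neg (isIntegral-* (isIntegral-ℕtoℚ 3) (lcmUpTo*H-isIntegral k≤n)))
                    (isIntegral-* (isIntegral-ℕtoℚ 2) (lcmUpTo*H-isIntegral (m∸n≤m n k)))))
      (n!*invFact-isIntegral k≤n))
    (isIntegral-* (isIntegral-* (isIntegral-ℕtoℚ B) (n!*invFact-isIntegral k≤n))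
      (lcmUpTo*innerSum-isIntegral n k)))
  where
  N L I : ℚ
  N = ℕtoℚ (n !)
  L = ℕtoℚ (lcmUpTo n)
  I = invFact k
  A B : ℕ
  B = (n C k) * (n C k)
  A = B * ((n ℕ.+ k) C k)
  distribute : ∀ N L A t w h₁ h₂ I B S →
    N *ℚ L *ℚ (A *ℚ (-ℚ (t *ℚ h₁) +ℚ w *ℚ h₂) *ℚ I -ℚ B *ℚ I *ℚ S)
      ≡ A *ℚ (-ℚ (t *ℚ (L *ℚ h₁)) +ℚ w *ℚ (L *ℚ h₂)) *ℚ (N *ℚ I) -ℚ B *ℚ (N *ℚ I) *ℚ (L *ℚ S)
  distribute = solve 10 (λ N L A t w h₁ h₂ I B S →
    N :* L :* (A :* (:- (t :* h₁) :+ w :* h₂) :* I :- B :* I :* S)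
      := A :* (:- (t :* (L :* h₁)) :+ w :* (L :* h₂)) :* (N :* I) :- B :* (N :* I) :* (L :* S)) refl
  n!L*coeff1≡ : ℕtoℚ ((n !) * lcmUpTo n) *ℚ coeff1 n k
    ≡ ℕtoℚ A *ℚ (-ℚ (ℕtoℚ 3 *ℚ (L *ℚ H k)) +ℚ ℕtoℚ 2 *ℚ (L *ℚ H (n ℕ.∸ k))) *ℚ (N *ℚ I)
        -ℚ ℕtoℚ B *ℚ (N *ℚ I) *ℚ (L *ℚ innerSum n k)
  n!L*coeff1≡ = trans (cong (_*ℚ coeff1 n k) (ℕtoℚ-* (n !) (lcmUpTo n)))
    (distribute N L (ℕtoℚ A) (ℕtoℚ 3) (ℕtoℚ 2) (H k) (H (n ℕ.∸ k)) I (ℕtoℚ B) (innerSum n k))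

coeff2-isIntegral : ∀ {n k} → k ≤ n → IsIntegral (ℕtoℚ (n !) *ℚ coeff2 n k)
coeff2-isIntegral {n} {k} k≤n =
  subst IsIntegral (sym (swap (ℕtoℚ (n !)) (ℕtoℚ A) (invFact k)))
    (isIntegral-* (isIntegral-ℕtoℚ A) (n!*invFact-isIntegral k≤n))
  where
  A : ℕ
  A = (n C k) * (n C k) * ((n ℕ.+ k) C k)
  swap : ∀ N A I → N *ℚ (A *ℚ I) ≡ A *ℚ (N *ℚ I)
  swap = solve 3 (λ N A I → N :* (A :* I) := A :* (N :* I)) refl

proposition2p6 : (n : ℕ) →
    InZx (scale (ℕtoℚ ((n !) * lcmUpTo n)) (F1 n)) × InZx (scale (ℕtoℚ (n !)) (F2 n))
proposition2p6 n =
  map⁺ (map-upTo⁺ (coeff1 n) (suc n) (λ k<1+n → coeff1-isIntegral (≤-pred k<1+n))) ,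
  map⁺ (map-upTo⁺ (coeff2 n) (suc n) (λ k<1+n → coeff2-isIntegral (≤-pred k<1+n)))
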